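{- Let $G$ be a necklace and let $a,b\in I_5=\{ -5,\dots,5\}$ be integers with $a\equiv b\pmod 2$. Then $G$ admits an $(a,b)$-pseudoflow if either $a\neq\pm b$, or $a=b=0$ and $\beta(G)\ge 2$.
   Context: A signed graph is a loopless graph (parallel edges allowed) with edges labelled positive or negative. An orientation treats each edge as two half-edges oriented independently: exactly one half-edge points towards its endvertex for a positive edge, none or both for a negative edge. Two-terminal graphs have distinct source and target; the series connection of $G_1,\dots,G_n$ identifies the target of $G_i$ with the source of $G_{i+1}$; the parallel connection identifies all sources into one vertex and all targets into one vertex. $K_2^+$ is the positive $K_2$ and $D$ the unbalanced $2$-cycle (one positive and one negative parallel edge). A string is a series connection of copies of $K_2^+$ and $D$ in which every non-terminal vertex lies in a $2$-cycle; it is nontrivial if it has more than two vertices. A necklace is the parallel connection of two strings, at least one of which is nontrivial. $\beta(G)$ is the number of distinct $2$-cycles in $G$. A pseudoflow on a two-terminal signed graph is an orientation with a valuation of edges by non-zero integers of absolute value less than $6$ such that at every non-terminal vertex the total value on incoming half-edges equals the total on outgoing half-edges (no condition at terminals); it is an $(a,b)$-pseudoflow if the net outflow at the source equals $a$ and the net inflow at the target equals $b$. -}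

module Defs where

open import Data.Nat as ℕ using (ℕ; zero; suc; _≤_; _<_)
open import Data.Integer as ℤ using (ℤ; +_; ∣_∣)
open import Data.Bool using (Bool; true; false; if_then_else_; _∧_)
open import Data.List using (List; []; _∷_; _++_; map; length; lookup)
open import Data.List.Relation.Unary.All using (All)
open import Data.List.Relation.Unary.Any using (Any)
open import Data.Fin using (Fin)
open import Data.Product using (Σ; _×_; _,_; ∃)
open import Data.Sum using (_⊎_)
open import Relation.Binary.PropositionalEquality using (_≡_; _≢_)
open import Relation.Nullary.Decidable using (⌊_⌋)

-- Signed graphs.  Vertices are labelled by natural numbers; a signed
-- graph is a list of edges (parallel edges = repeated entries).

data Sign : Set where
  pos neg : Sign

record Edge : Set where
  constructor edge
  field
    end₁ : ℕ
    end₂ : ℕ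
    sgn  : Sign
open Edge public

record TwoTerminal : Set where
  constructor tt-graph
  field
    edges  : List Edge
    source : ℕ
    target : ℕ
open TwoTerminal public

IsVertex : List Edge → ℕ → Set
IsVertex es v = Any (λ e → end₁ e ≡ v ⊎ end₂ e ≡ v) es

parallel? : Edge → Edge → Bool
parallel? e f =
  (⌊ end₁ e ℕ.≟ end₁ f ⌋ ∧ ⌊ end₂ e ℕ.≟ end₂ f ⌋) Data.Bool.∨
  (⌊ end₁ e ℕ.≟ end₂ f ⌋ ∧ ⌊ end₂ e ℕ.≟ end₁ f ⌋)

-- β(G): the number of distinct 2-cycles, i.e. unordered pairs of distinct
-- (positions of) edges with the same endvertices
countParallel : Edge → List Edge → ℕ
countParallel e []       = 0
countParallel e (f ∷ fs) = (if parallel? e f then 1 else 0) ℕ.+ countParallel e fs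

β : List Edge → ℕ
β []       = 0
β (e ∷ es) = countParallel e es ℕ.+ β es

InTwoCycle : List Edge → ℕ → Set
InTwoCycle es v = Σ (Fin (length es)) λ i → Σ (Fin (length es)) λ j →
  i ≢ j × parallel? (lookup es i) (lookup es j) ≡ true ×
  (end₁ (lookup es i) ≡ v ⊎ end₂ (lookup es i) ≡ v)

data Block : Set where
  K₂⁺ D : Block

blockEdges : ℕ → ℕ → Block → List Edge
blockEdges u v K₂⁺ = edge u v pos ∷ []
blockEdges u v D   = edge u v pos ∷ edge u v neg ∷ []

series : ℕ → ℕ → ℕ → List Block → List Edge
series s t nxt []             = []
series s t nxt (b ∷ [])       = blockEdges s t b
series s t nxt (b ∷ b′ ∷ bs)  = blockEdges s nxt b ++ series nxt t (suc nxt) (b′ ∷ bs)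

seriesGraph : List Block → TwoTerminal
seriesGraph bs = tt-graph (series 0 1 2 bs) 0 1

NonTerminal : TwoTerminal → ℕ → Set
NonTerminal G v = IsVertex (edges G) v × v ≢ source G × v ≢ target G

IsString : List Block → Set
IsString bs = bs ≢ [] ×
  (∀ v → NonTerminal (seriesGraph bs) v → InTwoCycle (edges (seriesGraph bs)) v)

-- nontrivial: more than two vertices
Nontrivial : List Block → Set
Nontrivial bs = ∃ λ v → NonTerminal (seriesGraph bs) v

-- parallel connection of the two strings bs₁ and bs₂ (common source 0,
-- common target 1, internal vertices of the two strings kept disjoint)
necklaceGraph : List Block → List Block → TwoTerminal
necklaceGraph bs₁ bs₂ =
  tt-graph (series 0 1 2 bs₁ ++ series 0 1 (2 ℕ.+ length bs₁) bs₂) 0 1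

IsNecklace : TwoTerminal → Set
IsNecklace G = Σ (List Block) λ bs₁ → Σ (List Block) λ bs₂ →
  IsString bs₁ × IsString bs₂ × (Nontrivial bs₁ ⊎ Nontrivial bs₂) ×
  G ≡ necklaceGraph bs₁ bs₂

-- Orientations and pseudoflows.
-- Each edge carries two half-edges; in₁ / in₂ say whether the half-edge at
-- end₁ / end₂ points towards its endvertex (i.e. is incoming there).

record ValuedEdge : Set where
  constructor valued
  field
    base : Edge
    in₁  : Bool
    in₂  : Bool
    val  : ℤ
open ValuedEdge public

ValidEdge : ValuedEdge → Set
ValidEdge x with sgn (base x)
... | pos = in₁ x ≢ in₂ x × val x ≢ + 0 × ∣ val x ∣ < 6
... | neg = in₁ x ≡ in₂ x × val x ≢ + 0 × ∣ val x ∣ < 6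

at : ℕ → ℕ → Bool → ℤ → ℤ
at w u b x = if ⌊ u ℕ.≟ w ⌋ ∧ b then x else + 0

not : Bool → Bool
not true  = false
not false = true

inflow : List ValuedEdge → ℕ → ℤ
inflow []       w = + 0
inflow (x ∷ xs) w =
  at w (end₁ (base x)) (in₁ x) (val x) ℤ.+ at w (end₂ (base x)) (in₂ x) (val x)
  ℤ.+ inflow xs w

outflow : List ValuedEdge → ℕ → ℤ
outflow []       w = + 0
outflow (x ∷ xs) w =
  at w (end₁ (base x)) (not (in₁ x)) (val x) ℤ.+ at w (end₂ (base x)) (not (in₂ x)) (val x)
  ℤ.+ outflow xs w

IsPseudoflow : TwoTerminal → ℤ → ℤ → List ValuedEdge → Set
IsPseudoflow G a b xs =
  map base xs ≡ edges G × All ValidEdge xs ×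
  (∀ w → w ≢ source G → w ≢ target G → inflow xs w ≡ outflow xs w) ×
  outflow xs (source G) ℤ.- inflow xs (source G) ≡ a ×
  inflow xs (target G) ℤ.- outflow xs (target G) ≡ b

HasPseudoflow : TwoTerminal → ℤ → ℤ → Set
HasPseudoflow G a b = ∃ λ xs → IsPseudoflow G a b xs

-- A necklace carries an (a,b)-pseudoflow as soon as its two strings carry flows entering
-- with values c₁, c₂ and leaving with d₁, d₂ where c₁ + c₂ = a and d₁ + d₂ = b.  Along a
-- string, K₂⁺ passes a nonzero value unchanged, while D turns c into any d of the same
-- parity with ∣ d ∣ ≠ ∣ c ∣.  Because every inner vertex of a string lies on a 2-cycle,
-- no two K₂⁺ are consecutive, and then the pairs (c,d) a string transmits depend only on
-- whether it starts or ends with K₂⁺ and on how its D blocks are arranged.  For these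
-- finitely many shapes the splitting of (a,b) is found by exhaustive search; it fails only
-- for a = b = 0 when K₂⁺ is in parallel with a string with a single D, and then β(G) = 1.
module Submission where

open import Defs
open import Data.Nat using (_≤_)
open import Data.Integer using (ℤ; +_; -_; _-_; ∣_∣)
open import Data.Integer.Divisibility using (_∣_)
open import Data.Product using (_×_)
open import Data.Sum using (_⊎_)
open import Relation.Binary.PropositionalEquality using (_≡_; _≢_)

open import Data.Bool using (Bool; true; false; T; if_then_else_; _∧_; _∨_)
open import Data.Bool.Properties using (T-≡; T-∧; T-∨)
open import Data.Empty using (⊥; ⊥-elim)
open import Data.Fin using (Fin; zero; suc)
import Data.Fin.Properties as Finₚ
open import Data.Integer as ℤ using (_+_; -[1+_])
import Data.Integer.Properties as ℤₚ
open import Data.Integer.Tactic.RingSolver using (solve-∀)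
open import Data.List using (List; []; _∷_; _++_; map; filter; length; lookup; upTo; downFrom)
open import Data.List.Membership.Propositional using (_∈_)
open import Data.List.Membership.Propositional.Properties
  using (∈-++⁺ˡ; ∈-++⁺ʳ; ∈-map⁺; ∈-upTo⁺; ∈-downFrom⁺)
open import Data.List.Properties using (map-++; filter-++; filter-none; filter-accept)
open import Data.List.Relation.Unary.All as All using (All; []; _∷_; all?)
open import Data.List.Relation.Unary.All.Properties using (++⁺; ¬Any⇒All¬)
open import Data.List.Relation.Unary.Any as Any using (Any; here; there; any?)
import Data.List.Relation.Unary.Any.Properties as Anyₚ
open import Data.Nat as ℕ using (ℕ; suc; _<_; s≤s; z≤n)
import Data.Nat.Divisibility as ℕ
import Data.Nat.Properties as ℕₚ
open import Data.Product using (∃; ∃₂; _,_; proj₁; proj₂)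
import Data.Product as Product
open import Data.Sum using (inj₁; inj₂; [_,_])
import Data.Sum as Sum
open import Data.Unit using (⊤; tt)
open import Function using (_∘_; id; Equivalence)
open import Relation.Binary.PropositionalEquality
  using (refl; sym; trans; cong; cong₂; subst; subst₂; module ≡-Reasoning)
open import Relation.Nullary using (Dec; yes; no; does; ¬_; ¬?)
open import Relation.Nullary.Decidable
  using (⌊_⌋; _×-dec_; _⊎-dec_; _→-dec_; T?; from-yes; toWitness)
open import Relation.Unary using (Pred; Decidable)

-- Transmission of values along a string

EdgeValue : ℤ → Set
EdgeValue x = x ≢ + 0 × ∣ x ∣ < 6

-- The values x of the positive and r of the negative edge of D, with the negative edge
-- oriented away from both of its ends.
DValues : ℤ → ℤ → ℤ → ℤ → Set
DValues c d x r = EdgeValue x × EdgeValue r × c ≡ x + r × d ≡ x - r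

Step : Block → ℤ → ℤ → Set
Step K₂⁺ c d = EdgeValue c × c ≡ d
Step D   c d = ∃₂ (DValues c d)

data Transmits : List Block → ℤ → ℤ → Set where
  []  : ∀ {c} → Transmits [] c c
  _∷_ : ∀ {b bs c e d} → Step b c e → Transmits bs e d → Transmits (b ∷ bs) c d

δ : ℕ → ℕ → ℤ → ℤ
δ u w x = if ⌊ u ℕ.≟ w ⌋ then x else + 0

δ-self : ∀ u x → δ u u x ≡ x
δ-self u x with u ℕ.≟ u
... | yes _   = refl
... | no u≢u = ⊥-elim (u≢u refl)

δ-other : ∀ {u w} x → u ≢ w → δ u w x ≡ + 0
δ-other {u} {w} x u≢w with u ℕ.≟ w
... | yes u≡w = ⊥-elim (u≢w u≡w)
... | no _    = refl

δ-+ : ∀ u w x y → δ u w (x + y) ≡ δ u w x + δ u w y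
δ-+ u w x y with u ℕ.≟ w
... | yes _ = refl
... | no _  = refl

δ-- : ∀ u w x y → δ u w (x - y) ≡ δ u w x - δ u w y
δ-- u w x y with u ℕ.≟ w
... | yes _ = refl
... | no _  = refl

at-true : ∀ w u x → at w u true x ≡ δ u w x
at-true w u x with u ℕ.≟ w
... | yes _ = refl
... | no _  = refl

at-false : ∀ w u x → at w u false x ≡ + 0
at-false w u x with u ℕ.≟ w
... | yes _ = refl
... | no _  = refl

net : List ValuedEdge → ℕ → ℤ
net xs w = outflow xs w - inflow xs w

outflow-++ : ∀ xs ys w → outflow (xs ++ ys) w ≡ outflow xs w + outflow ys w
outflow-++ []       ys w = sym (ℤₚ.+-identityˡ _)
outflow-++ (x ∷ xs) ys w rewrite outflow-++ xs ys w =
  sym (ℤₚ.+-assoc (at w (end₁ (base x)) (not (in₁ x)) (val x) +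
                   at w (end₂ (base x)) (not (in₂ x)) (val x))
                  (outflow xs w) (outflow ys w))

inflow-++ : ∀ xs ys w → inflow (xs ++ ys) w ≡ inflow xs w + inflow ys w
inflow-++ []       ys w = sym (ℤₚ.+-identityˡ _)
inflow-++ (x ∷ xs) ys w rewrite inflow-++ xs ys w =
  sym (ℤₚ.+-assoc (at w (end₁ (base x)) (in₁ x) (val x) + at w (end₂ (base x)) (in₂ x) (val x))
                  (inflow xs w) (inflow ys w))

net-++ : ∀ xs ys w → net (xs ++ ys) w ≡ net xs w + net ys w
net-++ xs ys w = trans (cong₂ _-_ (outflow-++ xs ys w) (inflow-++ xs ys w))
  (regroup (outflow xs w) (outflow ys w) (inflow xs w) (inflow ys w))
  where
  regroup : ∀ o o′ i i′ → (o + o′) - (i + i′) ≡ (o - i) + (o′ - i′)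
  regroup = solve-∀

record Flow (es : List Edge) (∂ : ℕ → ℤ) : Set where
  constructor flow
  field
    values : List ValuedEdge
    bases  : map base values ≡ es
    valid  : All ValidEdge values
    net≡∂  : ∀ w → net values w ≡ ∂ w

_++ᶠ_ : ∀ {es es′ ∂ ∂′} → Flow es ∂ → Flow es′ ∂′ → Flow (es ++ es′) (λ w → ∂ w + ∂′ w)
flow xs p v n ++ᶠ flow ys q u m =
  flow (xs ++ ys) (trans (map-++ base xs ys) (cong₂ _++_ p q)) (++⁺ v u)
       (λ w → trans (net-++ xs ys w) (cong₂ _+_ (n w) (m w)))

reshape : ∀ {es ∂ ∂′} → (∀ w → ∂ w ≡ ∂′ w) → Flow es ∂ → Flow es ∂′
reshape ∂≡∂′ (flow xs p v n) = flow xs p v (λ w → trans (n w) (∂≡∂′ w))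

through : ℕ → ℕ → ℤ → ℤ → ℕ → ℤ
through s t c d w = δ s w c - δ t w d

positiveFlow : ∀ {s t x} → EdgeValue x → Flow (edge s t pos ∷ []) (through s t x x)
positiveFlow {s} {t} {x} value = flow _ refl (((λ ()) , value) ∷ []) net≡
  where
  cancel : ∀ A B → ((A + + 0) + + 0) - ((+ 0 + B) + + 0) ≡ A - B
  cancel = solve-∀
  net≡ : ∀ w → net (valued (edge s t pos) false true x ∷ []) w ≡ through s t x x w
  net≡ w rewrite at-true w s x | at-false w t x | at-false w s x | at-true w t x =
    cancel (δ s w x) (δ t w x)

negativeFlow : ∀ {s t r} → EdgeValue r → Flow (edge s t neg ∷ []) (λ w → δ s w r + δ t w r)
negativeFlow {s} {t} {r} value = flow _ refl ((refl , value) ∷ []) net≡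
  where
  cancel : ∀ A B → ((A + B) + + 0) - ((+ 0 + + 0) + + 0) ≡ A + B
  cancel = solve-∀
  net≡ : ∀ w → net (valued (edge s t neg) false false r ∷ []) w ≡ δ s w r + δ t w r
  net≡ w rewrite at-true w s r | at-true w t r | at-false w s r | at-false w t r =
    cancel (δ s w r) (δ t w r)

blockFlow : ∀ {b s t c d} → Step b c d → Flow (blockEdges s t b) (through s t c d)
blockFlow {K₂⁺} (value , refl) = positiveFlow value
blockFlow {D} {s} {t} (x , r , valueˣ , valueʳ , refl , refl) =
  reshape combine (positiveFlow valueˣ ++ᶠ negativeFlow valueʳ)
  where
  regroup : ∀ A B C E → (A - B) + (C + E) ≡ (A + C) - (B - E)
  regroup = solve-∀
  combine : ∀ w → through s t x x w + (δ s w r + δ t w r) ≡ through s t (x + r) (x - r) w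
  combine w rewrite δ-+ s w x r | δ-- t w x r = regroup (δ s w x) (δ t w x) (δ s w r) (δ t w r)

seriesFlow : ∀ {bs s t n c d} → bs ≢ [] → Transmits bs c d →
  Flow (series s t n bs) (through s t c d)
seriesFlow {[]} nonempty [] = ⊥-elim (nonempty refl)
seriesFlow {_ ∷ []} _ (step ∷ []) = blockFlow step
seriesFlow {_ ∷ _ ∷ _} {s} {t} {n} {c} {d} _ (_∷_ {e = e} step steps) =
  reshape chain (blockFlow step ++ᶠ seriesFlow (λ ()) steps)
  where
  telescope : ∀ A B C → (A - B) + (B - C) ≡ A - C
  telescope = solve-∀
  chain : ∀ w → through s n c e w + through n t e d w ≡ through s t c d w
  chain w = telescope (δ s w c) (δ n w e) (δ t w d)

pseudoflow : ∀ {G a b} → source G ≢ target G →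
  Flow (edges G) (through (source G) (target G) a b) → HasPseudoflow G a b
pseudoflow {tt-graph _ s t} {a} {b} s≢t (flow xs p v n) =
  xs , p , v , conserved , atSource , atTarget
  where
  open ≡-Reasoning
  conserved : ∀ w → w ≢ s → w ≢ t → inflow xs w ≡ outflow xs w
  conserved w w≢s w≢t = sym (ℤₚ.i-j≡0⇒i≡j _ _ (begin
    net xs w                   ≡⟨ n w ⟩
    δ s w a - δ t w b          ≡⟨ cong₂ _-_ (δ-other a (w≢s ∘ sym)) (δ-other b (w≢t ∘ sym)) ⟩
    + 0                        ∎))
  atSource : outflow xs s - inflow xs s ≡ a
  atSource = begin
    net xs s                   ≡⟨ n s ⟩
    δ s s a - δ t s b          ≡⟨ cong₂ _-_ (δ-self s a) (δ-other b (s≢t ∘ sym)) ⟩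
    a - + 0                    ≡⟨ ℤₚ.+-identityʳ a ⟩
    a                          ∎
  atTarget : inflow xs t - outflow xs t ≡ b
  atTarget = begin
    inflow xs t - outflow xs t ≡⟨ reverse (outflow xs t) (inflow xs t) ⟩
    - net xs t                 ≡⟨ cong -_ (n t) ⟩
    - (δ s t a - δ t t b)      ≡⟨ cong -_ (cong₂ _-_ (δ-other a s≢t) (δ-self t b)) ⟩
    - (+ 0 - b)                ≡⟨ cong -_ (ℤₚ.+-identityˡ (- b)) ⟩
    - - b                      ≡⟨ ℤₚ.neg-involutive b ⟩
    b                          ∎
    where
    reverse : ∀ o i → i - o ≡ - (o - i)
    reverse = solve-∀

necklaceFlow : ∀ {bs₁ bs₂ c₁ d₁ c₂ d₂} → bs₁ ≢ [] → bs₂ ≢ [] →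
  Transmits bs₁ c₁ d₁ → Transmits bs₂ c₂ d₂ →
  HasPseudoflow (necklaceGraph bs₁ bs₂) (c₁ + c₂) (d₁ + d₂)
necklaceFlow {c₁ = c₁} {d₁} {c₂} {d₂} ne₁ ne₂ tr₁ tr₂ =
  pseudoflow (λ ()) (reshape sum (seriesFlow ne₁ tr₁ ++ᶠ seriesFlow ne₂ tr₂))
  where
  regroup : ∀ A B C E → (A - B) + (C - E) ≡ (A + C) - (B + E)
  regroup = solve-∀
  sum : ∀ w → through 0 1 c₁ d₁ w + through 0 1 c₂ d₂ w ≡ through 0 1 (c₁ + c₂) (d₁ + d₂) w
  sum w rewrite δ-+ 0 w c₁ c₂ | δ-+ 1 w d₁ d₂ = regroup (δ 0 w c₁) (δ 1 w d₁) (δ 0 w c₂) (δ 1 w d₂)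

-- Shapes of strings and the pairs they transmit

data Spacing : Set where
  single   : Spacing
  evenly   : Spacing
  oddly    : Spacing
  adjacent : Spacing

-- The shape of a string without two consecutive K₂⁺ that contains a D records whether it
-- starts or ends with K₂⁺ and whether its D's are a single one, an even or an odd number
-- (≥ 2) of pairwise non-adjacent ones, or include two adjacent ones.
data Shape : Set where
  K₂⁺-only : Shape
  withD    : (startsK endsK : Bool) → Spacing → Shape

next : Spacing → Spacing
next single   = evenly
next evenly   = oddly
next oddly    = evenly
next adjacent = adjacent

_◁_ : Block → Shape → Shape
K₂⁺ ◁ K₂⁺-only        = K₂⁺-only
K₂⁺ ◁ withD _ e k     = withD true e k
D   ◁ K₂⁺-only        = withD false true single
D   ◁ withD false e _ = withD false e adjacent
D   ◁ withD true  e k = withD false e (next k)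

-- The clause for [] only serves to give K₂⁺ ∷ [] the shape K₂⁺-only.
shapeOf : List Block → Shape
shapeOf []           = K₂⁺-only
shapeOf (K₂⁺ ∷ bs)   = K₂⁺ ◁ shapeOf bs
shapeOf (D ∷ [])     = withD false false single
shapeOf (D ∷ b ∷ bs) = D ◁ shapeOf (b ∷ bs)

TwoOrFour : ℕ → Set
TwoOrFour m = m ≡ 2 ⊎ m ≡ 4

-- Between two D's separated by K₂⁺ the value is nonzero and D changes its absolute value,
-- so on even values such a chain alternates between absolute values 2 and 4.
Spaced : Spacing → ℕ → ℕ → Set
Spaced single   m n = m ≢ n
Spaced evenly   m n = ¬ (TwoOrFour m × TwoOrFour n × m ≢ n)
Spaced oddly    m n = ¬ (TwoOrFour m × TwoOrFour n × m ≡ n)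
Spaced adjacent _ _ = ⊤

Admits : Shape → ℤ → ℤ → Set
Admits K₂⁺-only      c d = Step K₂⁺ c d
Admits (withD s e k) c d = ∣ c ∣ ≤ 5 × ∣ d ∣ ≤ 5 × (+ 2) ∣ (c - d) ×
  (T s → c ≢ + 0) × (T e → d ≢ + 0) × Spaced k (∣ c ∣) (∣ d ∣)

admits-bounded : ∀ σ {c d} → Admits σ c d → ∣ c ∣ ≤ 5 × ∣ d ∣ ≤ 5
admits-bounded K₂⁺-only ((_ , s≤s c≤5) , refl) = c≤5 , c≤5
admits-bounded (withD _ _ _) (c≤5 , d≤5 , _)   = c≤5 , d≤5

ContainsD : Shape → Set
ContainsD K₂⁺-only      = ⊥
ContainsD (withD _ _ _) = ⊤

Single : Shape → Set
Single K₂⁺-only      = ⊥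
Single (withD _ _ k) = k ≡ single

-- the necklaces carrying no (0,0)-pseudoflow
Exceptional : Shape → Shape → Set
Exceptional σ τ = (¬ ContainsD σ × Single τ) ⊎ (Single σ × ¬ ContainsD τ)

-- Starting and ending with K₂⁺ only forbids zero values, so these shapes transmit least.
core : Shape → Shape
core K₂⁺-only      = K₂⁺-only
core (withD _ _ k) = withD true true k

core-admits : ∀ σ {c d} → Admits (core σ) c d → Admits σ c d
core-admits K₂⁺-only      adm = adm
core-admits (withD s e k) (c≤5 , d≤5 , 2∣c-d , c≢0 , d≢0 , spaced) =
  c≤5 , d≤5 , 2∣c-d , (λ _ → c≢0 tt) , (λ _ → d≢0 tt) , spaced

core-containsD : ∀ σ → ContainsD σ → ContainsD (core σ)
core-containsD (withD _ _ _) _ = tt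

core-exceptional : ∀ σ τ → Exceptional (core σ) (core τ) → Exceptional σ τ
core-exceptional K₂⁺-only      K₂⁺-only      = id
core-exceptional K₂⁺-only      (withD _ _ _) = id
core-exceptional (withD _ _ _) K₂⁺-only      = id
core-exceptional (withD _ _ _) (withD _ _ _) = id

I₅ : List ℤ
I₅ = map -[1+_] (downFrom 5) ++ map +_ (upTo 6)

∈-I₅ : ∀ {c} → ∣ c ∣ ≤ 5 → c ∈ I₅
∈-I₅ {+ n}       n≤5 = ∈-++⁺ʳ (map -[1+_] (downFrom 5)) (∈-map⁺ +_ (∈-upTo⁺ (s≤s n≤5)))
∈-I₅ { -[1+ n ]} n<5 = ∈-++⁺ˡ (∈-map⁺ -[1+_] (∈-downFrom⁺ n<5))

onI₅² : ∀ {P : ℤ → ℤ → Set} → All (λ c → All (P c) I₅) I₅ →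
  ∀ {c d} → ∣ c ∣ ≤ 5 → ∣ d ∣ ≤ 5 → P c d
onI₅² table c≤5 d≤5 = All.lookup (All.lookup table (∈-I₅ c≤5)) (∈-I₅ d≤5)

spacings : List Spacing
spacings = single ∷ evenly ∷ oddly ∷ adjacent ∷ []

∈-spacings : ∀ k → k ∈ spacings
∈-spacings single   = here refl
∈-spacings evenly   = there (here refl)
∈-spacings oddly    = there (there (here refl))
∈-spacings adjacent = there (there (there (here refl)))

withDs : Bool → Bool → List Shape
withDs s e = map (withD s e) spacings

shapes : List Shape
shapes = K₂⁺-only ∷ withDs true true ++ withDs true false ++ withDs false true ++ withDs false false

∈-withDs : ∀ s e k → withD s e k ∈ withDs s e
∈-withDs s e k = ∈-map⁺ (withD s e) (∈-spacings k)

∈-shapes : ∀ σ → σ ∈ shapes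
∈-shapes K₂⁺-only              = here refl
∈-shapes (withD true true k)   = there (∈-++⁺ˡ (∈-withDs true true k))
∈-shapes (withD true false k)  = there (∈-++⁺ʳ (withDs true true) (∈-++⁺ˡ (∈-withDs true false k)))
∈-shapes (withD false true k)  = there (∈-++⁺ʳ (withDs true true) (∈-++⁺ʳ (withDs true false)
  (∈-++⁺ˡ (∈-withDs false true k))))
∈-shapes (withD false false k) = there (∈-++⁺ʳ (withDs true true) (∈-++⁺ʳ (withDs true false)
  (∈-++⁺ʳ (withDs false true) (∈-withDs false false k))))

coreShapes : List Shape
coreShapes = K₂⁺-only ∷ withDs true true

core∈coreShapes : ∀ σ → core σ ∈ coreShapes
core∈coreShapes K₂⁺-only      = here refl
core∈coreShapes (withD _ _ k) = there (∈-withDs true true k)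

edgeValue? : ∀ x → Dec (EdgeValue x)
edgeValue? x = ¬? (x ℤ.≟ + 0) ×-dec ∣ x ∣ ℕ.<? 6

single? : ∀ k → Dec (k ≡ single)
single? single   = yes refl
single? evenly   = no λ ()
single? oddly    = no λ ()
single? adjacent = no λ ()

twoOrFour? : ∀ m → Dec (TwoOrFour m)
twoOrFour? m = m ℕ.≟ 2 ⊎-dec m ℕ.≟ 4

spaced? : ∀ k m n → Dec (Spaced k m n)
spaced? single   m n = ¬? (m ℕ.≟ n)
spaced? evenly   m n = ¬? (twoOrFour? m ×-dec twoOrFour? n ×-dec ¬? (m ℕ.≟ n))
spaced? oddly    m n = ¬? (twoOrFour? m ×-dec twoOrFour? n ×-dec m ℕ.≟ n)
spaced? adjacent m n = yes tt

admits? : ∀ σ c d → Dec (Admits σ c d)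
admits? K₂⁺-only      c d = edgeValue? c ×-dec c ℤ.≟ d
admits? (withD s e k) c d = ∣ c ∣ ℕ.≤? 5 ×-dec ∣ d ∣ ℕ.≤? 5 ×-dec 2 ℕ.∣? ∣ c - d ∣ ×-dec
  (T? s →-dec ¬? (c ℤ.≟ + 0)) ×-dec (T? e →-dec ¬? (d ℤ.≟ + 0)) ×-dec spaced? k ∣ c ∣ ∣ d ∣

containsD? : ∀ σ → Dec (ContainsD σ)
containsD? K₂⁺-only      = no id
containsD? (withD _ _ _) = yes tt

isSingle? : ∀ σ → Dec (Single σ)
isSingle? K₂⁺-only      = no id
isSingle? (withD _ _ k) = single? k

exceptional? : ∀ σ τ → Dec (Exceptional σ τ)
exceptional? σ τ = (¬? (containsD? σ) ×-dec isSingle? τ) ⊎-dec (isSingle? σ ×-dec ¬? (containsD? τ))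

Demand : Shape → Shape → ℤ → ℤ → Set
Demand σ τ a b = (+ 2) ∣ (a - b) × ((a ≢ b × a ≢ - b) ⊎ (a ≡ + 0 × b ≡ + 0 × ¬ Exceptional σ τ))

-- Opaque, so that no later conversion check unfolds the tables.
opaque
  D-admits⇒step : ∀ {c d} → Admits (shapeOf (D ∷ [])) c d → Step D c d
  D-admits⇒step adm = let c≤5 , d≤5 = admits-bounded (shapeOf (D ∷ [])) adm in
    Product.map₂ Any.satisfied (Any.satisfied (onI₅² table c≤5 d≤5 adm))
    where
    table : All (λ c → All (λ d → Admits (shapeOf (D ∷ [])) c d →
              Any (λ x → Any (DValues c d x) I₅) I₅) I₅) I₅
    table = from-yes (all? (λ c → all? (λ d → admits? (shapeOf (D ∷ [])) c d →-dec
      any? (λ x → any? (λ r → edgeValue? x ×-dec edgeValue? r ×-dec c ℤ.≟ x + r ×-dec d ℤ.≟ x - r)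
        I₅) I₅) I₅) I₅)

  D◁-admits : ∀ σ {c d} → Admits (D ◁ σ) c d → ∃ λ e → Admits (shapeOf (D ∷ [])) c e × Admits σ e d
  D◁-admits σ adm = let c≤5 , d≤5 = admits-bounded (D ◁ σ) adm in
    Any.satisfied (onI₅² (All.lookup table (∈-shapes σ)) c≤5 d≤5 adm)
    where
    table : All (λ σ → All (λ c → All (λ d → Admits (D ◁ σ) c d →
              Any (λ e → Admits (shapeOf (D ∷ [])) c e × Admits σ e d) I₅) I₅) I₅) shapes
    table = from-yes (all? (λ σ → all? (λ c → all? (λ d → admits? (D ◁ σ) c d →-dec
      any? (λ e → admits? (shapeOf (D ∷ [])) c e ×-dec admits? σ e d) I₅) I₅) I₅) shapes)

  split : ∀ σ τ {a b} → ContainsD σ ⊎ ContainsD τ → ∣ a ∣ ≤ 5 → ∣ b ∣ ≤ 5 → Demand σ τ a b →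
    ∃₂ λ c d → Admits σ c d × Admits τ (a - c) (b - d)
  split σ τ {a} {b} hasD a≤5 b≤5 (2∣a-b , cases) =
    let c , d , adm₁ , adm₂ = satisfied² (onI₅² (All.lookup (All.lookup table (core∈coreShapes σ))
                                (core∈coreShapes τ)) a≤5 b≤5 coreHasD (2∣a-b , coreCases))
    in c , d , core-admits σ adm₁ , core-admits τ adm₂
    where
    satisfied² : ∀ {P : ℤ → ℤ → Set} → Any (λ c → Any (P c) I₅) I₅ → ∃₂ P
    satisfied² = Product.map₂ Any.satisfied ∘ Any.satisfied
    coreHasD : ContainsD (core σ) ⊎ ContainsD (core τ)
    coreHasD = Sum.map (core-containsD σ) (core-containsD τ) hasD
    coreCases : (a ≢ b × a ≢ - b) ⊎ (a ≡ + 0 × b ≡ + 0 × ¬ Exceptional (core σ) (core τ))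
    coreCases = Sum.map₂ (Product.map₂ (Product.map₂ (_∘ core-exceptional σ τ))) cases
    table : All (λ σ → All (λ τ → All (λ a → All (λ b → ContainsD σ ⊎ ContainsD τ → Demand σ τ a b →
              Any (λ c → Any (λ d → Admits σ c d × Admits τ (a - c) (b - d)) I₅) I₅)
            I₅) I₅) coreShapes) coreShapes
    table = from-yes (all? (λ σ → all? (λ τ → all? (λ a → all? (λ b →
      (containsD? σ ⊎-dec containsD? τ) →-dec
      (2 ℕ.∣? ∣ a - b ∣ ×-dec ((¬? (a ℤ.≟ b) ×-dec ¬? (a ℤ.≟ - b)) ⊎-dec
                               (a ℤ.≟ + 0 ×-dec b ℤ.≟ + 0 ×-dec ¬? (exceptional? σ τ)))) →-dec
      any? (λ c → any? (λ d → admits? σ c d ×-dec admits? τ (a - c) (b - d)) I₅) I₅)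
      I₅) I₅) coreShapes) coreShapes)

K₂⁺◁-admits : ∀ σ {c d} → Admits (K₂⁺ ◁ σ) c d → Step K₂⁺ c c × Admits σ c d
K₂⁺◁-admits K₂⁺-only      (value , refl) = (value , refl) , (value , refl)
K₂⁺◁-admits (withD _ _ _) (c≤5 , d≤5 , 2∣c-d , c≢0 , rest) =
  ((c≢0 tt , s≤s c≤5) , refl) , (c≤5 , d≤5 , 2∣c-d , (λ _ → c≢0 tt) , rest)

transmits : ∀ bs {c d} → Admits (shapeOf bs) c d → Transmits bs c d
transmits []           (_ , refl) = []
transmits (K₂⁺ ∷ bs)   adm =
  let step , adm′ = K₂⁺◁-admits (shapeOf bs) adm in step ∷ transmits bs adm′
transmits (D ∷ [])     adm = D-admits⇒step adm ∷ []
transmits (D ∷ b ∷ bs) adm =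
  let _ , admᴰ , adm′ = D◁-admits (shapeOf (b ∷ bs)) adm
  in D-admits⇒step admᴰ ∷ transmits (b ∷ bs) adm′

-- Strings have no two consecutive K₂⁺

module _ {a p} {A : Set a} {P : Pred A p} (P? : Decidable P) where

  lookup-filter : ∀ xs (i : Fin (length xs)) → P (lookup xs i) →
    ∃ λ k → lookup (filter P? xs) k ≡ lookup xs i
  lookup-filter (x ∷ xs) zero    px rewrite filter-accept P? {xs = xs} px = zero , refl
  lookup-filter (x ∷ xs) (suc i) pxᵢ with does (P? x) | lookup-filter xs i pxᵢ
  ... | true  | k , eq = suc k , eq
  ... | false | k , eq = k , eq

  lookup-filter² : ∀ xs {i j : Fin (length xs)} → i ≢ j →
    P (lookup xs i) → P (lookup xs j) →
    ∃₂ λ k l → k ≢ l × lookup (filter P? xs) k ≡ lookup xs i × lookup (filter P? xs) l ≡ lookup xs j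
  lookup-filter² (x ∷ xs) {zero}  {zero}  i≢j _ _ = ⊥-elim (i≢j refl)
  lookup-filter² (x ∷ xs) {zero}  {suc j} _ px pxⱼ rewrite filter-accept P? {xs = xs} px =
    let l , eq = lookup-filter xs j pxⱼ in zero , suc l , (λ ()) , refl , eq
  lookup-filter² (x ∷ xs) {suc i} {zero}  _ pxᵢ px rewrite filter-accept P? {xs = xs} px =
    let k , eq = lookup-filter xs i pxᵢ in suc k , zero , (λ ()) , eq , refl
  lookup-filter² (x ∷ xs) {suc i} {suc j} i≢j pxᵢ pxⱼ
    with does (P? x) | lookup-filter² xs (i≢j ∘ cong suc) pxᵢ pxⱼ
  ... | true  | k , l , k≢l , eqᵢ , eqⱼ = suc k , suc l , k≢l ∘ Finₚ.suc-injective , eqᵢ , eqⱼ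
  ... | false | k , l , k≢l , eqᵢ , eqⱼ = k , l , k≢l , eqᵢ , eqⱼ

Touches : ℕ → Edge → Set
Touches v e = end₁ e ≡ v ⊎ end₂ e ≡ v

touches? : ∀ v → Decidable (Touches v)
touches? v e = end₁ e ℕ.≟ v ⊎-dec end₂ e ℕ.≟ v

edgesAt : ℕ → List Edge → List Edge
edgesAt v = filter (touches? v)

Parallel : Edge → Edge → Set
Parallel e f = (end₁ e ≡ end₁ f × end₂ e ≡ end₂ f) ⊎ (end₁ e ≡ end₂ f × end₂ e ≡ end₁ f)

T-∨∧ : ∀ {A B C E : Set} (a? : Dec A) (b? : Dec B) (c? : Dec C) (e? : Dec E) →
  T ((⌊ a? ⌋ ∧ ⌊ b? ⌋) ∨ (⌊ c? ⌋ ∧ ⌊ e? ⌋)) → (A × B) ⊎ (C × E)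
T-∨∧ a? b? c? e? = Sum.map (both a? b?) (both c? e?) ∘ Equivalence.to (T-∨ {⌊ a? ⌋ ∧ ⌊ b? ⌋})
  where
  both : ∀ {A B : Set} (a? : Dec A) (b? : Dec B) → T (⌊ a? ⌋ ∧ ⌊ b? ⌋) → A × B
  both a? b? =
    Product.map (toWitness {a? = a?}) (toWitness {a? = b?}) ∘ Equivalence.to (T-∧ {⌊ a? ⌋})

parallel?-sound : ∀ {e f} → parallel? e f ≡ true → Parallel e f
parallel?-sound {e} {f} p =
  T-∨∧ (end₁ e ℕ.≟ end₁ f) (end₂ e ℕ.≟ end₂ f) (end₁ e ℕ.≟ end₂ f) (end₂ e ℕ.≟ end₁ f)
       (Equivalence.from T-≡ p)

parallel-touches : ∀ {v e f} → Parallel e f → Touches v e → Touches v f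
parallel-touches (inj₁ (p₁ , p₂)) = Sum.map (trans (sym p₁)) (trans (sym p₂))
parallel-touches (inj₂ (p₁ , p₂)) = Sum.swap ∘ Sum.map (trans (sym p₁)) (trans (sym p₂))

inTwoCycle-edgesAt : ∀ {es v} → InTwoCycle es v → InTwoCycle (edgesAt v es) v
inTwoCycle-edgesAt {es} {v} (i , j , i≢j , par , touchesᵢ) =
  let touchesⱼ = parallel-touches {v} {lookup es i} {lookup es j}
                   (parallel?-sound {lookup es i} {lookup es j} par) touchesᵢ
      k , l , k≢l , eqᵢ , eqⱼ = lookup-filter² (touches? v) es i≢j touchesᵢ touchesⱼ
  in k , l , k≢l , subst₂ (λ e f → parallel? e f ≡ true) (sym eqᵢ) (sym eqⱼ) par ,
     subst (Touches v) (sym eqᵢ) touchesᵢ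

no-twoCycle-path : ∀ {s n X v} → s ≢ n → s ≢ X →
  ¬ InTwoCycle (edge s n pos ∷ edge n X pos ∷ []) v
no-twoCycle-path _   _   (zero , zero , i≢j , _)              = i≢j refl
no-twoCycle-path {s} {n} {X} s≢n s≢X (zero , suc zero , _ , par , _) =
  [ s≢n ∘ proj₁ , s≢X ∘ proj₁ ] (parallel?-sound {edge s n pos} {edge n X pos} par)
no-twoCycle-path {s} {n} {X} s≢n s≢X (suc zero , zero , _ , par , _) =
  [ s≢n ∘ sym ∘ proj₁ , s≢X ∘ sym ∘ proj₂ ] (parallel?-sound {edge n X pos} {edge s n pos} par)
no-twoCycle-path _   _   (suc zero , suc zero , i≢j , _)      = i≢j refl

blockVertex : ∀ {s t v} b → IsVertex (blockEdges s t b) v → v ≡ s ⊎ v ≡ t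
blockVertex K₂⁺ (here touches)         = Sum.map sym sym touches
blockVertex D   (here touches)         = Sum.map sym sym touches
blockVertex D   (there (here touches)) = Sum.map sym sym touches

seriesVertex : ∀ {s t n v} bs → IsVertex (series s t n bs) v → v ≡ s ⊎ v ≡ t ⊎ n ≤ v
seriesVertex (b ∷ []) vertex = Sum.map₂ inj₁ (blockVertex b vertex)
seriesVertex {s} {t} {n} (b ∷ b′ ∷ bs) vertex =
  [ [ inj₁ , atN ] ∘ blockVertex b , [ atN , inj₂ ∘ Sum.map₂ ℕₚ.<⇒≤ ] ∘ seriesVertex (b′ ∷ bs) ]
    (Anyₚ.++⁻ (blockEdges s n b) vertex)
  where
  atN : ∀ {v} → v ≡ n → v ≡ s ⊎ v ≡ t ⊎ n ≤ v
  atN v≡n = inj₂ (inj₂ (ℕₚ.≤-reflexive (sym v≡n)))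

edgesAt-absent : ∀ {v} es → ¬ IsVertex es v → edgesAt v es ≡ []
edgesAt-absent {v} es absent = filter-none (touches? v) (¬Any⇒All¬ es absent)

edgesAt-block : ∀ {v s t} b → v ≢ s → v ≢ t → edgesAt v (blockEdges s t b) ≡ []
edgesAt-block {s = s} {t} b v≢s v≢t =
  edgesAt-absent (blockEdges s t b) ([ v≢s , v≢t ] ∘ blockVertex b)

edgesAt-series : ∀ {v s t n} bs → v ≢ s → v ≢ t → v < n → edgesAt v (series s t n bs) ≡ []
edgesAt-series {s = s} {t} {n} bs v≢s v≢t v<n =
  edgesAt-absent (series s t n bs) ([ v≢s , [ v≢t , ℕₚ.<⇒≱ v<n ] ] ∘ seriesVertex bs)

edgesAt-path : ∀ {v e f} rest → Touches v e → Touches v f → edgesAt v rest ≡ [] →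
  edgesAt v (e ∷ f ∷ rest) ≡ e ∷ f ∷ []
edgesAt-path {v} {e} {f} rest touchesᵉ touchesᶠ none = begin
  edgesAt v (e ∷ f ∷ rest)  ≡⟨ filter-accept (touches? v) touchesᵉ ⟩
  e ∷ edgesAt v (f ∷ rest)  ≡⟨ cong (e ∷_) (filter-accept (touches? v) touchesᶠ) ⟩
  e ∷ f ∷ edgesAt v rest    ≡⟨ cong (λ es → e ∷ f ∷ es) none ⟩
  e ∷ f ∷ []                ∎
  where open ≡-Reasoning

K₂⁺K₂⁺-no-twoCycle : ∀ {s t n} bs → s < n → t < n → s ≢ t →
  ¬ InTwoCycle (edgesAt n (series s t n (K₂⁺ ∷ K₂⁺ ∷ bs))) n
K₂⁺K₂⁺-no-twoCycle [] s<n t<n s≢t =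
  no-twoCycle-path (ℕₚ.<⇒≢ s<n) s≢t
  ∘ subst (λ es → InTwoCycle es _) (edgesAt-path [] (inj₂ refl) (inj₁ refl) refl)
K₂⁺K₂⁺-no-twoCycle {s} {t} {n} (b ∷ bs) s<n t<n s≢t =
  no-twoCycle-path (ℕₚ.<⇒≢ s<n) (ℕₚ.<⇒≢ (ℕₚ.m<n⇒m<1+n s<n))
  ∘ subst (λ es → InTwoCycle es n)
      (edgesAt-path _ (inj₂ refl) (inj₁ refl)
        (edgesAt-series (b ∷ bs) (ℕₚ.<⇒≢ (ℕₚ.n<1+n n)) (ℕₚ.<⇒≢ t<n ∘ sym)
                        (ℕₚ.m<n⇒m<1+n (ℕₚ.n<1+n n))))

InnerTwoCycles : ℕ → ℕ → List Edge → Set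
InnerTwoCycles s t es = ∀ v → IsVertex es v → v ≢ s → v ≢ t → InTwoCycle (edgesAt v es) v

innerTwoCycles-tail : ∀ {s t n} b {b′ bs} → s < n →
  InnerTwoCycles s t (series s t n (b ∷ b′ ∷ bs)) →
  InnerTwoCycles n t (series n t (suc n) (b′ ∷ bs))
innerTwoCycles-tail {s} {t} {n} b {b′} {bs} s<n cycles v vertex v≢n v≢t
  with seriesVertex (b′ ∷ bs) vertex
... | inj₁ v≡n        = ⊥-elim (v≢n v≡n)
... | inj₂ (inj₁ v≡t) = ⊥-elim (v≢t v≡t)
... | inj₂ (inj₂ n<v) =
  subst (λ es → InTwoCycle es v) dropBlock (cycles v (Anyₚ.++⁺ʳ (blockEdges s n b) vertex) v≢s v≢t)
  where
  v≢s : v ≢ s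
  v≢s v≡s = ℕₚ.<-asym s<n (subst (n <_) v≡s n<v)
  dropBlock : edgesAt v (series s t n (b ∷ b′ ∷ bs)) ≡ edgesAt v (series n t (suc n) (b′ ∷ bs))
  dropBlock = trans (filter-++ (touches? v) (blockEdges s n b) _)
                    (cong (_++ _) (edgesAt-block b v≢s v≢n))

data NoAdjacentK₂⁺ : List Block → Set where
  []    : NoAdjacentK₂⁺ []
  [K₂⁺] : NoAdjacentK₂⁺ (K₂⁺ ∷ [])
  D∷_   : ∀ {bs} → NoAdjacentK₂⁺ bs → NoAdjacentK₂⁺ (D ∷ bs)
  K₂⁺∷_ : ∀ {bs} → NoAdjacentK₂⁺ (D ∷ bs) → NoAdjacentK₂⁺ (K₂⁺ ∷ D ∷ bs)

noAdjacentK₂⁺ : ∀ bs {s t n} → s < n → t < n → s ≢ t →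
  InnerTwoCycles s t (series s t n bs) → NoAdjacentK₂⁺ bs
noAdjacentK₂⁺ []                 _   _   _   _      = []
noAdjacentK₂⁺ (K₂⁺ ∷ [])         _   _   _   _      = [K₂⁺]
noAdjacentK₂⁺ (D ∷ [])           _   _   _   _      = D∷ []
noAdjacentK₂⁺ (K₂⁺ ∷ K₂⁺ ∷ bs) {n = n} s<n t<n s≢t cycles = ⊥-elim
  (K₂⁺K₂⁺-no-twoCycle bs s<n t<n s≢t
    (cycles n (here (inj₂ refl)) (ℕₚ.<⇒≢ s<n ∘ sym) (ℕₚ.<⇒≢ t<n ∘ sym)))
noAdjacentK₂⁺ (K₂⁺ ∷ D ∷ bs)   s<n t<n s≢t cycles = K₂⁺∷ noAdjacentK₂⁺ (D ∷ bs) (ℕₚ.n<1+n _)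
  (ℕₚ.m<n⇒m<1+n t<n) (ℕₚ.<⇒≢ t<n ∘ sym) (innerTwoCycles-tail K₂⁺ {D} {bs} s<n cycles)
noAdjacentK₂⁺ (D ∷ b ∷ bs)     s<n t<n s≢t cycles = D∷ noAdjacentK₂⁺ (b ∷ bs) (ℕₚ.n<1+n _)
  (ℕₚ.m<n⇒m<1+n t<n) (ℕₚ.<⇒≢ t<n ∘ sym) (innerTwoCycles-tail D {b} {bs} s<n cycles)

string-noAdjacentK₂⁺ : ∀ {bs} → IsString bs → NoAdjacentK₂⁺ bs
string-noAdjacentK₂⁺ {bs} (_ , cycles) = noAdjacentK₂⁺ bs (s≤s z≤n) (s≤s (s≤s z≤n)) (λ ())
  λ v vertex v≢0 v≢1 → inTwoCycle-edgesAt {series 0 1 2 bs} (cycles v (vertex , v≢0 , v≢1))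

containsD-D∷ : ∀ bs → ContainsD (shapeOf (D ∷ bs))
containsD-D∷ []       = tt
containsD-D∷ (b ∷ bs) = D◁-containsD (shapeOf (b ∷ bs))
  where
  D◁-containsD : ∀ σ → ContainsD (D ◁ σ)
  D◁-containsD K₂⁺-only          = tt
  D◁-containsD (withD false _ _) = tt
  D◁-containsD (withD true _ _)  = tt

K₂⁺◁-containsD : ∀ σ → ContainsD σ → ContainsD (K₂⁺ ◁ σ)
K₂⁺◁-containsD (withD _ _ _) _ = tt

shape-without-D : ∀ {bs} → NoAdjacentK₂⁺ bs → ¬ ContainsD (shapeOf bs) → bs ≡ [] ⊎ bs ≡ K₂⁺ ∷ []
shape-without-D []             _     = inj₁ refl
shape-without-D [K₂⁺]          _     = inj₂ refl
shape-without-D (D∷_ {bs} _)   ¬hasD = ⊥-elim (¬hasD (containsD-D∷ bs))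
shape-without-D (K₂⁺∷_ {bs} _) ¬hasD = ⊥-elim (¬hasD (K₂⁺◁-containsD _ (containsD-D∷ bs)))

D◁-single : ∀ σ → Single (D ◁ σ) → ¬ ContainsD σ
D◁-single K₂⁺-only                _ = id
D◁-single (withD false _ _)       ()
D◁-single (withD true _ single)   ()
D◁-single (withD true _ evenly)   ()
D◁-single (withD true _ oddly)    ()
D◁-single (withD true _ adjacent) ()

K₂⁺◁-single : ∀ σ → Single (K₂⁺ ◁ σ) → Single σ
K₂⁺◁-single K₂⁺-only      ()
K₂⁺◁-single (withD _ _ _) = id

singleD-strings : List (List Block)
singleD-strings = (D ∷ []) ∷ (K₂⁺ ∷ D ∷ []) ∷ (D ∷ K₂⁺ ∷ []) ∷ (K₂⁺ ∷ D ∷ K₂⁺ ∷ []) ∷ []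

shape-single : ∀ {bs} → NoAdjacentK₂⁺ bs → Single (shapeOf bs) → bs ∈ singleD-strings
shape-single []    ()
shape-single [K₂⁺] ()
shape-single (D∷ []) _ = here refl
shape-single (D∷_ {b ∷ bs} noAdj) lone
  with shape-without-D noAdj (D◁-single (shapeOf (b ∷ bs)) lone)
... | inj₂ refl = there (there (here refl))
shape-single (K₂⁺∷_ {bs} noAdj) lone
  with shape-single noAdj (K₂⁺◁-single (shapeOf (D ∷ bs)) lone)
... | here refl                = there (here refl)
... | there (there (here refl)) = there (there (there (here refl)))
... | there (here ())
... | there (there (there (here ())))
... | there (there (there (there ())))

trivial-block : ∀ b → ¬ Nontrivial (b ∷ [])
trivial-block b (_ , vertex , v≢0 , v≢1) = [ v≢0 , v≢1 ] (blockVertex {0} {1} b vertex)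

string-without-D : ∀ {bs} → IsString bs → ¬ ContainsD (shapeOf bs) → bs ≡ K₂⁺ ∷ []
string-without-D str ¬hasD =
  [ ⊥-elim ∘ proj₁ str , id ] (shape-without-D (string-noAdjacentK₂⁺ str) ¬hasD)

nontrivial-containsD : ∀ {bs} → IsString bs → Nontrivial bs → ContainsD (shapeOf bs)
nontrivial-containsD {bs} str nontrivial with containsD? (shapeOf bs)
... | yes hasD  = hasD
... | no ¬hasD with refl ← string-without-D str ¬hasD = ⊥-elim (trivial-block K₂⁺ nontrivial)

K₂⁺∥singleD-β :
  All (λ bs → Nontrivial bs → β (edges (necklaceGraph (K₂⁺ ∷ []) bs)) ≡ 1) singleD-strings
K₂⁺∥singleD-β = (⊥-elim ∘ trivial-block D) ∷ (λ _ → refl) ∷ (λ _ → refl) ∷ (λ _ → refl) ∷ []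

singleD∥K₂⁺-β :
  All (λ bs → Nontrivial bs → β (edges (necklaceGraph bs (K₂⁺ ∷ []))) ≡ 1) singleD-strings
singleD∥K₂⁺-β = (⊥-elim ∘ trivial-block D) ∷ (λ _ → refl) ∷ (λ _ → refl) ∷ (λ _ → refl) ∷ []

exceptional-β : ∀ {bs₁ bs₂} → IsString bs₁ → IsString bs₂ → Nontrivial bs₁ ⊎ Nontrivial bs₂ →
  Exceptional (shapeOf bs₁) (shapeOf bs₂) → β (edges (necklaceGraph bs₁ bs₂)) ≡ 1
exceptional-β str₁ str₂ nontrivial (inj₁ (¬hasD , lone))
  with refl ← string-without-D str₁ ¬hasD =
  All.lookup K₂⁺∥singleD-β (shape-single (string-noAdjacentK₂⁺ str₂) lone)
    ([ ⊥-elim ∘ trivial-block K₂⁺ , id ] nontrivial)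
exceptional-β str₁ str₂ nontrivial (inj₂ (lone , ¬hasD))
  with refl ← string-without-D str₂ ¬hasD =
  All.lookup singleD∥K₂⁺-β (shape-single (string-noAdjacentK₂⁺ str₁) lone)
    ([ id , ⊥-elim ∘ trivial-block K₂⁺ ] nontrivial)

lemma15 : (G : TwoTerminal) → IsNecklace G → (a b : ℤ) →
    ∣ a ∣ ≤ 5 → ∣ b ∣ ≤ 5 → (+ 2) ∣ (a - b) →
    ((a ≢ b × a ≢ - b) ⊎ (a ≡ + 0 × b ≡ + 0 × 2 ≤ β (edges G))) →
    HasPseudoflow G a b
lemma15 _ (bs₁ , bs₂ , str₁ , str₂ , nontrivial , refl) a b a≤5 b≤5 2∣a-b cases =
  let c , d , adm₁ , adm₂ = split (shapeOf bs₁) (shapeOf bs₂) containsD a≤5 b≤5 (2∣a-b , demand)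
  in subst₂ (HasPseudoflow (necklaceGraph bs₁ bs₂)) (c+[a-c]≡a c a) (c+[a-c]≡a d b)
       (necklaceFlow (proj₁ str₁) (proj₁ str₂) (transmits bs₁ adm₁) (transmits bs₂ adm₂))
  where
  c+[a-c]≡a : ∀ c a → c + (a - c) ≡ a
  c+[a-c]≡a = solve-∀
  containsD : ContainsD (shapeOf bs₁) ⊎ ContainsD (shapeOf bs₂)
  containsD = Sum.map (nontrivial-containsD str₁) (nontrivial-containsD str₂) nontrivial
  unexceptional : 2 ≤ β (edges (necklaceGraph bs₁ bs₂)) → ¬ Exceptional (shapeOf bs₁) (shapeOf bs₂)
  unexceptional 2≤β exceptional =
    ℕₚ.<-irrefl refl (subst (2 ≤_) (exceptional-β str₁ str₂ nontrivial exceptional) 2≤β)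
  demand : (a ≢ b × a ≢ - b) ⊎ (a ≡ + 0 × b ≡ + 0 × ¬ Exceptional (shapeOf bs₁) (shapeOf bs₂))
  demand = Sum.map₂ (Product.map₂ (Product.map₂ unexceptional)) cases
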